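{- Let $c,r$ be positive integers and let the universe have $n=r^2+c\,r$ elements. Suppose that at some time the budgets of all elements in $\mathrm{DLM}_c$ are zero. Let $A$ be the set of the last $c+r$ elements on $\mathrm{DLM}_c$'s list. Consider a phase: $c+1$ consecutive requests, each equal to the set of the last $r$ elements of $\mathrm{DLM}_c$'s current list at the time of that request. After $\mathrm{DLM}_c$ serves the phase: (i) the budgets of all elements are again zero; (ii) the first $c+r$ positions are occupied by the elements of $A$, in an order that is a cyclic shift of their original relative order; (iii) every element not in $A$ has its position increased by $c+r$. Furthermore, the cost of $\mathrm{DLM}_c$ during the phase is at least $(c+r)(n-r)$.
   Context: Online Min-Sum Set Cover. A list is a permutation $\pi:\mathcal U\to\{1,\dots,n\}$ of a universe $\mathcal U$ of $n$ elements. A request is a nonempty subset $R\subseteq\mathcal U$. The algorithm pays access cost $\min_{z\in R}\pi(z)$ and one unit per adjacent swap when reordering. Algorithm $\mathrm{DLM}_c$, where $c$ is a positive integer. Every element $z$ has a budget $b(z)$, initially $0$. The operation fetch$(z)$ moves $z$ to position 1 by $\pi(z)-1$ adjacent swaps, shifting the elements that preceded $z$ back by one, and then sets $b(z)\gets0$. On a request $R$, let $x\in R$ be the element of $R$ with the smallest current position and let $\ell=\pi(x)$. $\mathrm{DLM}_c$ pays $\ell$, executes fetch$(x)$, and sets $b(y)\gets b(y)+\ell/c$ for every $y\in R\setminus\{x\}$. Then, while some element $z$ has $b(z)\ge\pi(z)$, it fetches such elements to the front. If $k>1$ elements satisfy $b(z)\ge\pi(z)$ simultaneously, $\mathrm{DLM}_c$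 fetches them to the first $k$ positions preserving their relative order. -}

module Defs where

open import Data.Nat using (ℕ; zero; suc; _+_; _*_; _∸_; _≤ᵇ_)
open import Data.Bool using (Bool; true; false; if_then_else_; _∧_; not)
open import Data.Fin using (Fin) renaming (_≟_ to _≟ᶠ_)
open import Data.List using (List; []; _∷_; _++_; map; length; drop)
open import Data.List.Membership.Propositional using (_∈_)
open import Data.List.Relation.Unary.All using (All)
open import Data.Product using (_×_; _,_; proj₁; proj₂)
open import Relation.Nullary using (¬_; does)
open import Relation.Binary.PropositionalEquality using (_≡_; _≢_)

-- A state of DLM_c is its list (front first) where every
-- element carries its budget.  The stored budget is SCALED by c:
-- stored value = c · b(z).  Since every budget increment ℓ/c becomes ℓ,
-- all scaled budgets are natural numbers; b(z) ≥ π(z) iff stored ≥ c · π(z).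
State : ℕ → Set
State n = List (Fin n × ℕ)

elems : ∀ {n} → State n → List (Fin n)
elems = map proj₁

_∈ᵇ_ : ∀ {n} → Fin n → List (Fin n) → Bool
y ∈ᵇ [] = false
y ∈ᵇ (z ∷ zs) = if does (y ≟ᶠ z) then true else (y ∈ᵇ zs)

-- 1-based position of z in a list (first occurrence; length+1 if absent).
pos : ∀ {n} → Fin n → List (Fin n) → ℕ
pos z [] = 1
pos z (y ∷ ys) = if does (z ≟ᶠ y) then 1 else suc (pos z ys)

-- After serving x with access cost ℓ: b(y) += ℓ/c (scaled: += ℓ) for y ∈ R \ {x}.
addBudget : ∀ {n} → List (Fin n) → Fin n → ℕ → State n → State n
addBudget R x ℓ = map (λ p → if ((proj₁ p ∈ᵇ R) ∧ not (does (proj₁ p ≟ᶠ x)))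
                               then (proj₁ p , proj₂ p + ℓ) else p)

-- One round of the eligibility check: scan the list; i = 0-based index of
-- the current element, j = number of eligible elements found before it.
-- Element at position i+1 is eligible iff c·(i+1) ≤ scaled budget.
-- Returns (eligible elements with budget reset to 0, in original order;
--          remaining elements in original order;
--          number of adjacent swaps = Σ over eligible (old pos − new pos)).
scan : ∀ {n} → ℕ → ℕ → ℕ → State n → State n × State n × ℕ
scan c i j [] = [] , [] , 0
scan c i j ((y , b) ∷ s) with c * suc i ≤ᵇ b
... | true  = let (E , Rest , k) = scan c (suc i) (suc j) s
              in ((y , 0) ∷ E) , Rest , ((i ∸ j) + k)
... | false = let (E , Rest , k) = scan c (suc i) j s
              in E , ((y , b) ∷ Rest) , k

-- The "while some element is eligible" loop, as a big-step relation
-- Cascade c s s' k : starting in s, the loop terminates in s' with swap cost k.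
-- In each round all currently eligible elements are fetched simultaneously
-- to the front, preserving their relative order.
data Cascade {n} (c : ℕ) : State n → State n → ℕ → Set where
  done : ∀ {s} → proj₁ (scan c 0 0 s) ≡ [] → Cascade c s s 0
  step : ∀ {s s' k} → proj₁ (scan c 0 0 s) ≢ [] →
         Cascade c (proj₁ (scan c 0 0 s) ++ proj₁ (proj₂ (scan c 0 0 s))) s' k →
         Cascade c s s' (proj₂ (proj₂ (scan c 0 0 s)) + k)

-- Serving one request R (given as a list of elements):
-- x = first element of the list lying in R, at position ℓ = length pre + 1.
-- Cost: ℓ (access) + (ℓ − 1) (swaps of fetch x) + swaps of the cascade.
data Serve {n} (c : ℕ) (R : List (Fin n)) : State n → State n → ℕ → Set where
  serve : ∀ pre x b suf {s' k} →
          All (λ p → ¬ (proj₁ p ∈ R)) pre → x ∈ R →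
          Cascade c (addBudget R x (suc (length pre)) ((x , 0) ∷ pre ++ suf)) s' k →
          Serve c R (pre ++ (x , b) ∷ suf) s'
                (suc (length pre) + length pre + k)

lastR : ∀ {n} → ℕ → State n → List (Fin n)
lastR r s = elems (drop (length s ∸ r) s)

data Phase {n} (c r : ℕ) : ℕ → State n → State n → ℕ → Set where
  nil  : ∀ {s} → Phase c r 0 s s 0
  cons : ∀ {m s s₁ s₂ k₁ k₂} → Serve c (lastR r s) s s₁ k₁ →
         Phase c r m s₁ s₂ k₂ → Phase c r (suc m) s s₂ (k₁ + k₂)

{-# OPTIONS --safe #-}
-- With all budgets zero the list is Pre ++ B ++ x ∷ T, where x ∷ T are the last r elements
-- and |B| = c, and the first requested element is always at position ℓ = n − r + 1.  The
-- requests fetch x and then B from the back, each adding ℓ to the scaled budgets of T,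
-- which sits at positions ℓ + 1, …, n.  After j ≤ c requests these budgets are j·ℓ < c·(ℓ+1),
-- so nothing else moves; after the (c+1)-st they are (c+1)·ℓ ≥ c·(ℓ + r − 1) because
-- c(r − 1) ≤ n − r, so all of T is fetched at once.  The list becomes T ++ B ++ x ∷ Pre
-- with zero budgets, at cost (c+1)(2ℓ − 1) + (r − 1)ℓ ≥ (c + r)(n − r).  DLM is
-- deterministic, so every run of the phase is this one.
module Submission where

open import Defs
open import Data.Nat using (ℕ; zero; suc; _+_; _*_; _∸_; _≤_; _<_; s≤s; _≤ᵇ_; NonZero; >-nonZero)
open import Data.Nat.Properties
open import Data.Nat.Tactic.RingSolver using (solve-∀)
open import Data.Bool as Bool using (true; false)
open import Data.Unit using (tt)
open import Data.Fin using (Fin) renaming (_≟_ to _≟ᶠ_)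
open import Data.List using (List; []; _∷_; _∷ʳ_; [_]; _++_; take; drop; map; length; allFin)
open import Data.List.Properties using (map-∘; map-id; map-++; length-map; length-++; ++-assoc; ++-identityʳ; ∷-injective; drop-map; length-tabulate)
open import Data.List.Reverse using (Reverse; []; _∶_∶ʳ_; reverseView)
open import Data.List.Membership.Propositional using (_∈_; _∉_)
open import Data.List.Membership.Propositional.Properties using (∈-++⁺ˡ; ∈-++⁺ʳ; ∈-++⁻; ∈-allFin)
open import Data.List.Relation.Unary.Any using (here; there)
open import Data.List.Relation.Unary.All as All using (All; []; _∷_)
import Data.List.Relation.Unary.All.Properties as All
open import Data.List.Relation.Unary.AllPairs using (_∷_)
open import Data.List.Relation.Unary.Unique.Propositional using (Unique)
open import Data.List.Relation.Unary.Unique.Propositional.Properties using (allFin⁺)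
open import Data.List.Relation.Binary.Permutation.Propositional using (_↭_; ↭-sym; ↭⇒↭ₛ)
open import Data.List.Relation.Binary.Permutation.Propositional.Properties using (↭-length; ∈-resp-↭; ++-comm; shift)
import Data.List.Relation.Binary.Permutation.Setoid.Properties as ↭ₛ
open import Data.Product using (Σ-syntax; ∃; ∃₂; _×_; _,_; proj₁; proj₂; map₁; map₂)
open import Data.Sum using (inj₁; inj₂)
open import Data.Empty using (⊥-elim)
open import Function using (_∘_; case_of_)
open import Relation.Nullary using (¬_; yes; no)
open import Relation.Binary.PropositionalEquality using (_≡_; _≢_; refl; sym; trans; cong; cong₂; subst; subst₂; setoid; module ≡-Reasoning)

length-∷ʳ : ∀ {A : Set} (xs : List A) x → length (xs ∷ʳ x) ≡ suc (length xs)
length-∷ʳ xs x = trans (length-++ xs) (+-comm (length xs) 1)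

take-++-length : ∀ {A : Set} {m} (xs ys : List A) → length xs ≡ m → take m (xs ++ ys) ≡ xs
take-++-length []       ys refl = refl
take-++-length (x ∷ xs) ys refl = cong (x ∷_) (take-++-length xs ys refl)

drop-++-length : ∀ {A : Set} {m} (xs ys : List A) → length xs ≡ m → drop m (xs ++ ys) ≡ ys
drop-++-length []       ys refl = refl
drop-++-length (x ∷ xs) ys refl = drop-++-length xs ys refl

split-by-lengths : ∀ {A : Set} a b (xs : List A) → length xs ≡ a + b →
  ∃₂ λ ys zs → xs ≡ ys ++ zs × length ys ≡ a × length zs ≡ b
split-by-lengths zero    b xs       |xs| = [] , xs , refl , refl , |xs|
split-by-lengths (suc a) b (x ∷ xs) |xs| with split-by-lengths a b xs (suc-injective |xs|)
... | ys , zs , refl , |ys| , |zs| = x ∷ ys , zs , refl , cong suc |ys| , |zs|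

first-split-unique : ∀ {A : Set} {P : A → Set} {xs ys : List A} {x y xs′ ys′} →
  All P xs → ¬ P x → All P ys → ¬ P y → xs ++ x ∷ xs′ ≡ ys ++ y ∷ ys′ →
  xs ≡ ys × x ≡ y × xs′ ≡ ys′
first-split-unique []         _  []         _  refl = refl , refl , refl
first-split-unique []         ¬x (py ∷ _)   _  refl = ⊥-elim (¬x py)
first-split-unique (px ∷ _)   _  []         ¬y refl = ⊥-elim (¬y px)
first-split-unique (_ ∷ Pxs) ¬x (_ ∷ Pys) ¬y eq with ∷-injective eq
... | refl , eq′ with first-split-unique Pxs ¬x Pys ¬y eq′
...   | refl , refl , refl = refl , refl , refl

Unique-resp-↭ : ∀ {A : Set} {xs ys : List A} → xs ↭ ys → Unique xs → Unique ys
Unique-resp-↭ {A} p = ↭ₛ.Unique-resp-↭ (setoid A) (↭⇒↭ₛ p)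

Unique-++⇒∉ : ∀ {A : Set} (xs : List A) {ys x} → Unique (xs ++ ys) → x ∈ xs → x ∉ ys
Unique-++⇒∉ (_ ∷ xs) (x∉ ∷ _) (here refl) x∈ys = All.lookup x∉ (∈-++⁺ʳ xs x∈ys) refl
Unique-++⇒∉ (_ ∷ xs) (_ ∷ u)  (there x∈xs) = Unique-++⇒∉ xs u x∈xs

request-disjoint : ∀ {A : Set} (Q : List A) {y T} → Unique (Q ++ y ∷ T) → All (_∉ y ∷ T) Q × y ∉ T
request-disjoint Q {y} {T} u = All.tabulate (Unique-++⇒∉ Q u) , y∉T (Unique-resp-↭ (++-comm Q (y ∷ T)) u)
  where
  y∉T : Unique ((y ∷ T) ++ Q) → y ∉ T
  y∉T (y∉ ∷ _) y∈T = All.lookup y∉ (∈-++⁺ˡ y∈T) refl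

pos-++-∈ : ∀ {n} {z : Fin n} xs ys → z ∈ xs → pos z (xs ++ ys) ≡ pos z xs
pos-++-∈ {z = z} (x ∷ xs) ys z∈ with z ≟ᶠ x | z∈
... | yes _   | _           = refl
... | no z≢x  | here z≡x    = ⊥-elim (z≢x z≡x)
... | no _    | there z∈xs  = cong suc (pos-++-∈ xs ys z∈xs)

pos-++-∉ : ∀ {n} {z : Fin n} xs ys → z ∉ xs → pos z (xs ++ ys) ≡ length xs + pos z ys
pos-++-∉ []       ys _  = refl
pos-++-∉ {z = z} (x ∷ xs) ys z∉ with z ≟ᶠ x
... | yes z≡x = ⊥-elim (z∉ (here z≡x))
... | no _    = cong suc (pos-++-∉ xs ys (z∉ ∘ there))

withBudget : ∀ {n} → ℕ → List (Fin n) → State n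
withBudget b = map (_, b)

elems-withBudget : ∀ {n} b (xs : List (Fin n)) → elems (withBudget b xs) ≡ xs
elems-withBudget b xs = trans (sym (map-∘ xs)) (map-id xs)

withBudget-∷ʳ : ∀ {n} b (xs : List (Fin n)) x (s : State n) →
  withBudget b (xs ∷ʳ x) ++ s ≡ withBudget b xs ++ (x , b) ∷ s
withBudget-∷ʳ b []       x s = refl
withBudget-∷ʳ b (y ∷ xs) x s = cong ((y , b) ∷_) (withBudget-∷ʳ b xs x s)

all-withBudget0 : ∀ {n} (xs : List (Fin n)) → All (λ p → proj₂ p ≡ 0) (withBudget 0 xs)
all-withBudget0 xs = All.map⁺ (All.universal (λ _ → refl) xs)

zero-budgets⇒withBudget0 : ∀ {n} {s : State n} → All (λ p → proj₂ p ≡ 0) s → s ≡ withBudget 0 (elems s)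
zero-budgets⇒withBudget0 []                 = refl
zero-budgets⇒withBudget0 {s = (x , _) ∷ _} (refl ∷ zeros) = cong ((x , 0) ∷_) (zero-budgets⇒withBudget0 zeros)

∈⇒∈ᵇ : ∀ {n} {z : Fin n} {zs} → z ∈ zs → (z ∈ᵇ zs) ≡ true
∈⇒∈ᵇ {z = z} {y ∷ _} z∈ with z ≟ᶠ y | z∈
... | yes _   | _          = refl
... | no z≢y  | here z≡y   = ⊥-elim (z≢y z≡y)
... | no _    | there z∈zs = ∈⇒∈ᵇ z∈zs

∉⇒∉ᵇ : ∀ {n} {z : Fin n} {zs} → z ∉ zs → (z ∈ᵇ zs) ≡ false
∉⇒∉ᵇ {zs = []} _ = refl
∉⇒∉ᵇ {z = z} {y ∷ _} z∉ with z ≟ᶠ y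
... | yes z≡y = ⊥-elim (z∉ (here z≡y))
... | no _    = ∉⇒∉ᵇ (z∉ ∘ there)

addBudget-∉ : ∀ {n} {R : List (Fin n)} x ℓ b Q → All (_∉ R) Q →
  addBudget R x ℓ (withBudget b Q) ≡ withBudget b Q
addBudget-∉ x ℓ b []      []           = refl
addBudget-∉ x ℓ b (q ∷ Q) (q∉R ∷ Q∉R) rewrite ∉⇒∉ᵇ q∉R = cong ((q , b) ∷_) (addBudget-∉ x ℓ b Q Q∉R)

addBudget-∈ : ∀ {n} {R : List (Fin n)} x ℓ b T → All (_∈ R) T → All (_≢ x) T →
  addBudget R x ℓ (withBudget b T) ≡ withBudget (b + ℓ) T
addBudget-∈ x ℓ b []      []           []          = refl
addBudget-∈ x ℓ b (t ∷ T) (t∈R ∷ T∈R) (t≢x ∷ T≢x) rewrite ∈⇒∈ᵇ t∈R with t ≟ᶠ x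
... | yes t≡x = ⊥-elim (t≢x t≡x)
... | no _    = cong ((t , b + ℓ) ∷_) (addBudget-∈ x ℓ b T T∈R T≢x)

addBudget-request : ∀ {n} (Q : List (Fin n)) y T β ℓ → All (_∉ y ∷ T) Q → y ∉ T →
  addBudget (y ∷ T) y ℓ ((y , 0) ∷ withBudget 0 Q ++ withBudget β T)
    ≡ (y , 0) ∷ withBudget 0 Q ++ withBudget (β + ℓ) T
addBudget-request Q y T β ℓ Q∉ y∉T with y ≟ᶠ y
... | no y≢y = ⊥-elim (y≢y refl)
... | yes _  = cong ((y , 0) ∷_) (begin
      addBudget (y ∷ T) y ℓ (withBudget 0 Q ++ withBudget β T)
        ≡⟨ map-++ _ (withBudget 0 Q) (withBudget β T) ⟩
      addBudget (y ∷ T) y ℓ (withBudget 0 Q) ++ addBudget (y ∷ T) y ℓ (withBudget β T)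
        ≡⟨ cong₂ _++_ (addBudget-∉ y ℓ 0 Q Q∉) (addBudget-∈ y ℓ β T (All.tabulate there) T≢y) ⟩
      withBudget 0 Q ++ withBudget (β + ℓ) T ∎)
  where
  open ≡-Reasoning
  T≢y : All (_≢ y) T
  T≢y = All.tabulate (λ t∈T t≡y → y∉T (subst (_∈ T) t≡y t∈T))

scan-withBudget0 : ∀ {n} c .{{_ : NonZero c}} i j (Q : List (Fin n)) →
  proj₁ (scan c i j (withBudget 0 Q)) ≡ []
scan-withBudget0 (suc c) i j []      = refl
scan-withBudget0 (suc c) i j (_ ∷ Q) = scan-withBudget0 (suc c) (suc i) j Q

scan-withBudget0-++ : ∀ {n} c .{{_ : NonZero c}} i j (Q : List (Fin n)) s →
  scan c i j (withBudget 0 Q ++ s) ≡ map₂ (map₁ (withBudget 0 Q ++_)) (scan c (i + length Q) j s)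
scan-withBudget0-++ (suc c) i j []      s rewrite +-identityʳ i = refl
scan-withBudget0-++ (suc c) i j (q ∷ Q) s
  rewrite scan-withBudget0-++ (suc c) (suc i) j Q s | +-suc i (length Q) = refl

scan-ineligible : ∀ {n} c b i j (xs : List (Fin n)) → b < c * suc i →
  scan c i j (withBudget b xs) ≡ ([] , withBudget b xs , 0)
scan-ineligible c b i j []      _ = refl
scan-ineligible c b i j (t ∷ xs) b< with c * suc i ≤ᵇ b in eligible
... | true  = ⊥-elim (<⇒≱ b< (≤ᵇ⇒≤ (c * suc i) b (subst Bool.T (sym eligible) tt)))
... | false rewrite scan-ineligible c b (suc i) j xs (<-≤-trans b< (*-monoʳ-≤ c (n≤1+n (suc i)))) = refl

-- Every eligible element moves (j + ℓ) ∸ j = ℓ places forward.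
scan-eligible : ∀ {n} c b ℓ j (xs : List (Fin n)) → c * (length xs + (j + ℓ)) ≤ b →
  scan c (j + ℓ) j (withBudget b xs) ≡ (withBudget 0 xs , [] , length xs * ℓ)
scan-eligible c b ℓ j []      _ = refl
scan-eligible c b ℓ j (t ∷ xs) c*≤b with c * suc (j + ℓ) ≤ᵇ b in eligible
... | false = ⊥-elim (subst Bool.T eligible (≤⇒≤ᵇ (≤-trans (*-monoʳ-≤ c (s≤s (m≤n+m (j + ℓ) (length xs)))) c*≤b)))
... | true rewrite scan-eligible c b ℓ (suc j) xs (subst (λ m → c * m ≤ b) (sym (+-suc (length xs) (j + ℓ))) c*≤b)
                 | m+n∸m≡n j ℓ = refl

scan-[]⇒unchanged : ∀ {n} c i j (s : State n) → proj₁ (scan c i j s) ≡ [] →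
  proj₁ (proj₂ (scan c i j s)) ≡ s × proj₂ (proj₂ (scan c i j s)) ≡ 0
scan-[]⇒unchanged c i j []            _ = refl , refl
scan-[]⇒unchanged c i j ((y , b) ∷ s) none with c * suc i ≤ᵇ b
... | true  = case none of λ ()
... | false = map₁ (cong ((y , b) ∷_)) (scan-[]⇒unchanged c (suc i) j s none)

cascade-deterministic : ∀ {n c} {s s₁ s₂ : State n} {k₁ k₂} →
  Cascade c s s₁ k₁ → Cascade c s s₂ k₂ → s₁ ≡ s₂ × k₁ ≡ k₂
cascade-deterministic (done _)    (done _)    = refl , refl
cascade-deterministic (done none) (step some _) = ⊥-elim (some none)
cascade-deterministic (step some _) (done none) = ⊥-elim (some none)
cascade-deterministic (step _ p₁) (step _ p₂) with cascade-deterministic p₁ p₂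
... | refl , refl = refl , refl

serve-deterministic : ∀ {n c R} {s s₁ s₂ : State n} {k₁ k₂} →
  Serve c R s s₁ k₁ → Serve c R s s₂ k₂ → s₁ ≡ s₂ × k₁ ≡ k₂
serve-deterministic {R = R} sv₁ sv₂ = go sv₁ sv₂ refl
  where
  go : ∀ {s t s₁ s₂ k₁ k₂} → Serve _ R s s₁ k₁ → Serve _ R t s₂ k₂ → s ≡ t → s₁ ≡ s₂ × k₁ ≡ k₂
  go (serve _ _ _ _ pre₁∉R x₁∈R casc₁) (serve _ _ _ _ pre₂∉R x₂∈R casc₂) eq
    with first-split-unique pre₁∉R (λ x₁∉R → x₁∉R x₁∈R) pre₂∉R (λ x₂∉R → x₂∉R x₂∈R) eq
  ... | refl , refl , refl with cascade-deterministic casc₁ casc₂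
  ...   | refl , refl = refl , refl

phase-deterministic : ∀ {n c r m} {s s₁ s₂ : State n} {k₁ k₂} →
  Phase c r m s s₁ k₁ → Phase c r m s s₂ k₂ → s₁ ≡ s₂ × k₁ ≡ k₂
phase-deterministic nil            nil              = refl , refl
phase-deterministic (cons sv₁ p₁) (cons sv₂ p₂) with serve-deterministic sv₁ sv₂
... | refl , refl with phase-deterministic p₁ p₂
...   | refl , refl = refl , refl

every-run-agrees : ∀ {n c r m} {s s₁ : State n} {k₁} {P : State n → ℕ → Set} →
  Phase c r m s s₁ k₁ → P s₁ k₁ → ∀ s₂ k₂ → Phase c r m s s₂ k₂ → P s₂ k₂
every-run-agrees p₁ holds _ _ p₂ with phase-deterministic p₁ p₂
... | refl , refl = holds

cascade-zeroing : ∀ {n} c .{{_ : NonZero c}} (s : State n) E V k →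
  scan c 0 0 s ≡ (withBudget 0 E , withBudget 0 V , k) → Cascade c s (withBudget 0 (E ++ V)) k
cascade-zeroing c s [] V k scan≡ = subst₂ (Cascade c s) s≡ k≡ (done none)
  where
  none = cong proj₁ scan≡
  s≡ : s ≡ withBudget 0 V
  s≡ = trans (sym (proj₁ (scan-[]⇒unchanged c 0 0 s none))) (cong (proj₁ ∘ proj₂) scan≡)
  k≡ : 0 ≡ k
  k≡ = trans (sym (proj₂ (scan-[]⇒unchanged c 0 0 s none))) (cong (proj₂ ∘ proj₂) scan≡)
cascade-zeroing c s (e ∷ E) V k scan≡ =
  subst (Cascade c s (withBudget 0 (e ∷ E ++ V))) (trans (+-identityʳ _) (cong (proj₂ ∘ proj₂) scan≡))
    (step (λ none → case trans (sym (cong proj₁ scan≡)) none of λ ())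
      (subst (λ s′ → Cascade c s′ (withBudget 0 (e ∷ E ++ V)) 0) (sym fetched≡)
        (done (scan-withBudget0 c 0 0 (e ∷ E ++ V)))))
  where
  fetched≡ : proj₁ (scan c 0 0 s) ++ proj₁ (proj₂ (scan c 0 0 s)) ≡ withBudget 0 (e ∷ E ++ V)
  fetched≡ = trans (cong (λ t → proj₁ t ++ proj₁ (proj₂ t)) scan≡) (sym (map-++ _ (e ∷ E) V))

serve-first-requested : ∀ {n} c (Q : List (Fin n)) y T β {s′ k} → All (_∉ y ∷ T) Q → y ∉ T →
  Cascade c ((y , 0) ∷ withBudget 0 Q ++ withBudget (β + suc (length Q)) T) s′ k →
  Serve c (y ∷ T) (withBudget 0 Q ++ (y , 0) ∷ withBudget β T) s′ (suc (length Q) + length Q + k)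
serve-first-requested c Q y T β {s′} {k} Q∉ y∉T casc =
  subst (λ m → Serve c (y ∷ T) (withBudget 0 Q ++ (y , 0) ∷ withBudget β T) s′ (suc m + m + k))
        (length-map _ Q)
    (serve (withBudget 0 Q) y 0 (withBudget β T) (All.map⁺ Q∉) (here refl)
      (subst (λ s → Cascade c s s′ k) (sym added) casc))
  where
  added : addBudget (y ∷ T) y (suc (length (withBudget 0 Q))) ((y , 0) ∷ withBudget 0 Q ++ withBudget β T)
            ≡ (y , 0) ∷ withBudget 0 Q ++ withBudget (β + suc (length Q)) T
  added rewrite length-map (_, 0) Q = addBudget-request Q y T β (suc (length Q)) Q∉ y∉T

serve-quiet : ∀ {n} c .{{_ : NonZero c}} L (Q : List (Fin n)) y T β → length Q ≡ L →
  All (_∉ y ∷ T) Q → y ∉ T → β + suc L < c * suc (suc L) →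
  Serve c (y ∷ T) (withBudget 0 Q ++ (y , 0) ∷ withBudget β T)
    ((y , 0) ∷ withBudget 0 Q ++ withBudget (β + suc L) T) (suc L + L)
serve-quiet c _ Q y T β refl Q∉ y∉T quiet =
  subst (Serve c (y ∷ T) _ _) (+-identityʳ _)
    (serve-first-requested c Q y T β Q∉ y∉T (done nothing-eligible))
  where
  nothing-eligible : proj₁ (scan c 0 0 ((y , 0) ∷ withBudget 0 Q ++ withBudget (β + suc (length Q)) T)) ≡ []
  nothing-eligible = trans (cong proj₁ (scan-withBudget0-++ c 0 0 (y ∷ Q) _))
    (cong proj₁ (scan-ineligible c (β + suc (length Q)) (suc (length Q)) 0 T quiet))

serve-final : ∀ {n} c .{{_ : NonZero c}} L r′ (Q : List (Fin n)) y T β → length Q ≡ L → length T ≡ r′ →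
  All (_∉ y ∷ T) Q → y ∉ T → c * (r′ + suc L) ≤ β + suc L →
  Serve c (y ∷ T) (withBudget 0 Q ++ (y , 0) ∷ withBudget β T)
    (withBudget 0 (T ++ y ∷ Q)) (suc L + L + r′ * suc L)
serve-final c _ _ Q y T β refl refl Q∉ y∉T all-eligible =
  serve-first-requested c Q y T β Q∉ y∉T (cascade-zeroing c _ T (y ∷ Q) _ scan≡)
  where
  B = β + suc (length Q)
  scan≡ : scan c 0 0 ((y , 0) ∷ withBudget 0 Q ++ withBudget B T)
            ≡ (withBudget 0 T , withBudget 0 (y ∷ Q) , length T * suc (length Q))
  scan≡ = begin
    scan c 0 0 ((y , 0) ∷ withBudget 0 Q ++ withBudget B T)
      ≡⟨ scan-withBudget0-++ c 0 0 (y ∷ Q) (withBudget B T) ⟩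
    map₂ (map₁ (withBudget 0 (y ∷ Q) ++_)) (scan c (suc (length Q)) 0 (withBudget B T))
      ≡⟨ cong (map₂ (map₁ (withBudget 0 (y ∷ Q) ++_))) (scan-eligible c B (suc (length Q)) 0 T all-eligible) ⟩
    (withBudget 0 T , withBudget 0 (y ∷ Q) ++ [] , length T * suc (length Q))
      ≡⟨ cong (λ V → withBudget 0 T , V , length T * suc (length Q)) (++-identityʳ _) ⟩
    (withBudget 0 T , withBudget 0 (y ∷ Q) , length T * suc (length Q)) ∎
    where open ≡-Reasoning

lastR-++ : ∀ {n} r (s t : State n) → length t ≡ r → lastR r (s ++ t) ≡ elems t
lastR-++ r s t refl = trans
  (cong (λ m → elems (drop m (s ++ t))) (trans (cong (_∸ length t) (length-++ s)) (m+n∸n≡m (length s) (length t))))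
  (cong elems (drop-++-length s t refl))

-- L = n − r elements precede the requested block throughout the phase, so every request
-- finds its first requested element at position suc L.
module PhaseRun {n : ℕ} (c : ℕ) {{_ : NonZero c}} (L r′ : ℕ) (c*r′≤L : c * r′ ≤ L) where

  request : ∀ {Q y T β m s₁ s₂ k₁ k₂} → length T ≡ r′ →
    Serve c (y ∷ T) (withBudget 0 Q ++ (y , 0) ∷ withBudget β T) s₁ k₁ → Phase c (suc r′) m s₁ s₂ k₂ →
    Phase {n} c (suc r′) (suc m) (withBudget 0 Q ++ (y , 0) ∷ withBudget β T) s₂ (k₁ + k₂)
  request {Q} {y} {T} {β} |T| sv p = cons (subst (λ R → Serve c R _ _ _) (sym requested≡) sv) p
    where
    requested≡ : lastR (suc r′) (withBudget 0 Q ++ (y , 0) ∷ withBudget β T) ≡ y ∷ T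
    requested≡ = trans (lastR-++ (suc r′) (withBudget 0 Q) _ (cong suc (trans (length-map _ T) |T|)))
                       (cong (y ∷_) (elems-withBudget β T))

  -- The remaining requests fetch y and then D from the back; each adds suc L to the scaled
  -- budget β of T, which therefore reaches c · suc L exactly at the last request.
  phase-run : ∀ {D : List (Fin n)} → Reverse D → ∀ {m} → length D ≡ m → ∀ W y T β →
    length W + length D ≡ L → length T ≡ r′ → β + m * suc L ≡ c * suc L → Unique ((W ++ D) ++ y ∷ T) →
    Phase c (suc r′) (suc m) (withBudget 0 (W ++ D) ++ (y , 0) ∷ withBudget β T)
      (withBudget 0 (T ++ D ++ y ∷ W)) (suc m * (suc L + L) + r′ * suc L)
  phase-run [] refl W y T β |W| |T| β≡ unique =
    subst (λ Q → Phase c (suc r′) 1 (withBudget 0 Q ++ rest) final _) (sym (++-identityʳ W))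
      (subst (Phase c (suc r′) 1 (withBudget 0 W ++ rest) final) cost≡
        (request |T| (serve-final c L r′ W y T β (trans (sym (+-identityʳ _)) |W|) |T| W∉ y∉T all-eligible) nil))
    where
    open ≤-Reasoning
    rest = (y , 0) ∷ withBudget β T
    final = withBudget 0 (T ++ y ∷ W)
    disjoint = request-disjoint W (subst (λ Q → Unique (Q ++ y ∷ T)) (++-identityʳ W) unique)
    W∉ = proj₁ disjoint
    y∉T = proj₂ disjoint
    all-eligible : c * (r′ + suc L) ≤ β + suc L
    all-eligible = begin
      c * (r′ + suc L)     ≡⟨ *-distribˡ-+ c r′ (suc L) ⟩
      c * r′ + c * suc L   ≤⟨ +-monoˡ-≤ (c * suc L) (≤-trans c*r′≤L (n≤1+n L)) ⟩
      suc L + c * suc L    ≡⟨ +-comm (suc L) _ ⟩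
      c * suc L + suc L    ≡⟨ cong (_+ suc L) (trans (sym β≡) (+-identityʳ β)) ⟩
      β + suc L            ∎
    cost≡ : suc L + L + r′ * suc L + 0 ≡ 1 * (suc L + L) + r′ * suc L
    cost≡ = trans (+-identityʳ _) (cong (_+ r′ * suc L) (sym (+-identityʳ _)))
  phase-run (D ∶ _ ∶ʳ _) {zero} |D| = case trans (sym (length-∷ʳ D _)) |D| of λ ()
  phase-run (D ∶ rs ∶ʳ y′) {suc m} |D∷ʳy′| W y T β |W| |T| β≡ unique =
    subst₂ (Phase c (suc r′) (suc (suc m)) before)
      (cong (λ V → withBudget 0 (T ++ V)) (sym (++-assoc D [ y′ ] (y ∷ W))))
      (sym (+-assoc (suc L + L) (suc m * (suc L + L)) (r′ * suc L)))
      (request |T| (subst (λ s → Serve c (y ∷ T) before s (suc L + L)) fetched≡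
                      (serve-quiet c L Q y T β |Q| Q∉ y∉T quiet))
        (phase-run rs |D| (y ∷ W) y′ T (β + suc L) |y∷W| |T| β′≡ unique′))
    where
    open ≤-Reasoning
    Q = W ++ D ∷ʳ y′
    before = withBudget 0 Q ++ (y , 0) ∷ withBudget β T
    Q≡ : Q ≡ (W ++ D) ∷ʳ y′
    Q≡ = sym (++-assoc W D [ y′ ])
    |D| : length D ≡ m
    |D| = suc-injective (trans (sym (length-∷ʳ D y′)) |D∷ʳy′|)
    |Q| : length Q ≡ L
    |Q| = trans (length-++ W) |W|
    |y∷W| : length (y ∷ W) + length D ≡ L
    |y∷W| = trans (sym (+-suc (length W) (length D))) (trans (cong (length W +_) (sym (length-∷ʳ D y′))) |W|)
    disjoint = request-disjoint Q unique
    Q∉ = proj₁ disjoint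
    y∉T = proj₂ disjoint
    quiet : β + suc L < c * suc (suc L)
    quiet = begin-strict
      β + suc L                ≤⟨ +-monoʳ-≤ β (m≤m+n (suc L) (m * suc L)) ⟩
      β + suc m * suc L        ≡⟨ β≡ ⟩
      c * suc L                <⟨ *-monoʳ-< c (n<1+n (suc L)) ⟩
      c * suc (suc L)          ∎
    β′≡ : β + suc L + m * suc L ≡ c * suc L
    β′≡ = trans (+-assoc β (suc L) (m * suc L)) β≡
    fetched≡ : (y , 0) ∷ withBudget 0 Q ++ withBudget (β + suc L) T
                 ≡ withBudget 0 ((y ∷ W) ++ D) ++ (y′ , 0) ∷ withBudget (β + suc L) T
    fetched≡ = cong ((y , 0) ∷_) (trans (cong (λ V → withBudget 0 V ++ _) Q≡) (withBudget-∷ʳ 0 (W ++ D) y′ _))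
    unique′ : Unique (((y ∷ W) ++ D) ++ y′ ∷ T)
    unique′ = subst Unique (cong (y ∷_) (trans (cong (_++ T) Q≡) (++-assoc (W ++ D) [ y′ ] T)))
                (Unique-resp-↭ (shift y Q T) unique)

record ZeroBudgetSplit {n} (s : State n) (q c r′ : ℕ) : Set where
  field
    Pre B    : List (Fin n)
    x       : Fin n
    T       : List (Fin n)
    s≡      : s ≡ withBudget 0 (Pre ++ B ++ x ∷ T)
    |Pre|    : length Pre ≡ q
    |B|     : length B ≡ c
    |T|     : length T ≡ r′
    unique  : Unique (Pre ++ B ++ x ∷ T)
    covers  : ∀ z → z ∈ Pre ++ B ++ x ∷ T

zero-budget-split : ∀ {n} {s : State n} q c r′ → elems s ↭ allFin n → All (λ p → proj₂ p ≡ 0) s →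
  q + (c + suc r′) ≡ n → ZeroBudgetSplit s q c r′
zero-budget-split {n} {s} q c r′ s↭ zeros size
  with split-by-lengths q (c + suc r′) (elems s) (trans (↭-length s↭) (trans (length-tabulate _) (sym size)))
... | Pre , A , es≡ , |Pre| , |A| with split-by-lengths c (suc r′) A |A|
...   | B , x ∷ T , refl , |B| , |xT| = record
  { Pre = Pre ; B = B ; x = x ; T = T
  ; s≡ = trans (zero-budgets⇒withBudget0 zeros) (cong (withBudget 0) es≡)
  ; |Pre| = |Pre| ; |B| = |B| ; |T| = suc-injective |xT|
  ; unique = subst Unique es≡ (Unique-resp-↭ (↭-sym s↭) (allFin⁺ n))
  ; covers = λ z → subst (z ∈_) es≡ (∈-resp-↭ (↭-sym s↭) (∈-allFin z))
  }

module PhaseFrom {n : ℕ} {s : State n} {q c r′ : ℕ} {{_ : NonZero c}} (split : ZeroBudgetSplit s q c r′)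
  (size : q + (c + suc r′) ≡ n) (c*r′≤ : c * r′ ≤ q + c) where
  open ZeroBudgetSplit split

  L = q + c
  A = B ++ x ∷ T

  final : State n
  final = withBudget 0 (T ++ B ++ x ∷ Pre)

  cost : ℕ
  cost = suc c * (suc L + L) + r′ * suc L

  final-zero : All (λ p → proj₂ p ≡ 0) final
  final-zero = all-withBudget0 (T ++ B ++ x ∷ Pre)

  run : Phase c (suc r′) (suc c) s final cost
  run = subst (λ s → Phase c (suc r′) (suc c) s final cost) (sym (trans s≡ initial≡))
          (PhaseRun.phase-run c L r′ c*r′≤ (reverseView B) |B| Pre x T 0 (cong₂ _+_ |Pre| |B|) |T| refl
            (subst Unique (sym (++-assoc Pre B (x ∷ T))) unique))
    where
    initial≡ : withBudget 0 (Pre ++ A) ≡ withBudget 0 (Pre ++ B) ++ (x , 0) ∷ withBudget 0 T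
    initial≡ = trans (cong (withBudget 0) (sym (++-assoc Pre B (x ∷ T)))) (map-++ _ (Pre ++ B) (x ∷ T))

  requested : elems (drop q s) ≡ A
  requested = begin
    elems (drop q s)                          ≡⟨ cong (elems ∘ drop q) s≡ ⟩
    elems (drop q (withBudget 0 (Pre ++ A)))   ≡⟨ cong elems (drop-map q (Pre ++ A)) ⟩
    elems (withBudget 0 (drop q (Pre ++ A)))   ≡⟨ cong (elems ∘ withBudget 0) (drop-++-length Pre A |Pre|) ⟩
    elems (withBudget 0 A)                    ≡⟨ elems-withBudget 0 A ⟩
    A                                         ∎
    where open ≡-Reasoning

  private
    B∷ʳx = B ∷ʳ x
    A≡ : A ≡ B∷ʳx ++ T
    A≡ = sym (++-assoc B [ x ] T)
    |B∷ʳx| : length B∷ʳx ≡ suc c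
    |B∷ʳx| = trans (length-∷ʳ B x) (cong suc |B|)
    front≡ : T ++ B ++ x ∷ Pre ≡ (T ++ B∷ʳx) ++ Pre
    front≡ = trans (cong (T ++_) (sym (++-assoc B [ x ] Pre))) (sym (++-assoc T B∷ʳx Pre))
    |front| : length (T ++ B∷ʳx) ≡ c + suc r′
    |front| = trans (length-++ T) (trans (cong₂ _+_ |T| |B∷ʳx|) (trans (+-comm r′ (suc c)) (sym (+-suc c r′))))

  front-rotated : take (c + suc r′) (elems final) ≡ drop (suc c) (elems (drop q s)) ++ take (suc c) (elems (drop q s))
  front-rotated rewrite requested | elems-withBudget 0 (T ++ B ++ x ∷ Pre) | front≡ | A≡ =
    trans (take-++-length (T ++ B∷ʳx) Pre |front|)
      (cong₂ _++_ (sym (drop-++-length B∷ʳx T |B∷ʳx|)) (sym (take-++-length B∷ʳx T |B∷ʳx|)))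

  rest-shifted : ∀ z → z ∉ elems (drop q s) → pos z (elems final) ≡ pos z (elems s) + (c + suc r′)
  rest-shifted z z∉ rewrite requested | elems-withBudget 0 (T ++ B ++ x ∷ Pre) | s≡ | elems-withBudget 0 (Pre ++ A) | front≡ =
    trans (pos-++-∉ (T ++ B∷ʳx) Pre (z∉ ∘ z∈A))
      (trans (cong₂ _+_ |front| (sym (pos-++-∈ Pre A z∈Pre))) (+-comm (c + suc r′) _))
    where
    z∈A : z ∈ T ++ B∷ʳx → z ∈ A
    z∈A z∈ = subst (z ∈_) (sym A≡) (∈-resp-↭ (++-comm T B∷ʳx) z∈)
    z∈Pre : z ∈ Pre
    z∈Pre with ∈-++⁻ Pre (covers z)
    ... | inj₁ z∈Pre = z∈Pre
    ... | inj₂ z∈A′ = ⊥-elim (z∉ z∈A′)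

  cost-bound : (c + suc r′) * (n ∸ suc r′) ≤ cost
  cost-bound = begin
    (c + suc r′) * (n ∸ suc r′)   ≡⟨ cong₂ _*_ (+-suc c r′) n∸r≡L ⟩
    (suc c + r′) * L              ≡⟨ *-distribʳ-+ L (suc c) r′ ⟩
    suc c * L + r′ * L            ≤⟨ +-mono-≤ (*-monoʳ-≤ (suc c) (m≤n+m L (suc L))) (*-monoʳ-≤ r′ (n≤1+n L)) ⟩
    cost                          ∎
    where
    open ≤-Reasoning
    n∸r≡L : n ∸ suc r′ ≡ L
    n∸r≡L = trans (cong (_∸ suc r′) (trans (sym size) (sym (+-assoc q c (suc r′))))) (m+n∸n≡m L (suc r′))

universe-size : ∀ c r′ → (r′ * suc r′ + c * r′) + (c + suc r′) ≡ suc r′ * suc r′ + c * suc r′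
universe-size = solve-∀

module UniverseSize (c r′ : ℕ) where
  n = suc r′ * suc r′ + c * suc r′
  q = n ∸ (c + suc r′)

  private
    n≡ : (r′ * suc r′ + c * r′) + (c + suc r′) ≡ n
    n≡ = universe-size c r′

    q≡ : q ≡ r′ * suc r′ + c * r′
    q≡ = trans (cong (_∸ (c + suc r′)) (sym n≡)) (m+n∸n≡m _ (c + suc r′))

  size : q + (c + suc r′) ≡ n
  size = trans (cong (_+ (c + suc r′)) q≡) n≡

  c*r′≤q+c : c * r′ ≤ q + c
  c*r′≤q+c = ≤-trans (m≤n+m (c * r′) (r′ * suc r′)) (≤-trans (≤-reflexive (sym q≡)) (m≤m+n q c))

lemma15 : (c r : ℕ) → 1 ≤ c → 1 ≤ r →
    (s : State (r * r + c * r)) →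
    elems s ↭ allFin (r * r + c * r) →
    All (λ p → proj₂ p ≡ 0) s →
    (Σ[ s' ∈ State (r * r + c * r) ] Σ[ k ∈ ℕ ] Phase c r (suc c) s s' k)
    × ((s' : State (r * r + c * r)) (k : ℕ) → Phase c r (suc c) s s' k →
         All (λ p → proj₂ p ≡ 0) s'
       × (∃ λ j → take (c + r) (elems s') ≡
                    drop j (elems (drop ((r * r + c * r) ∸ (c + r)) s))
                    ++ take j (elems (drop ((r * r + c * r) ∸ (c + r)) s)))
       × ((z : Fin (r * r + c * r)) →
            ¬ (z ∈ elems (drop ((r * r + c * r) ∸ (c + r)) s)) →
            pos z (elems s') ≡ pos z (elems s) + (c + r))
       × ((c + r) * ((r * r + c * r) ∸ r) ≤ k))
lemma15 c (suc r′) c≥1 _ s s↭ zeros =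
    (final , cost , run)
  , every-run-agrees run (final-zero , (suc c , front-rotated) , rest-shifted , cost-bound)
  where
  instance
    c≢0 : NonZero c
    c≢0 = >-nonZero c≥1
  open UniverseSize c r′
  open PhaseFrom (zero-budget-split q c r′ s↭ zeros size) size c*r′≤q+c
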